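{- There exists a connected undirected graph $G$ for which there is no natural isomorphism $\psi_G:\mathbf{C}\mathcal{T}(G)\to\mathbf{C}K(G)$; that is, there is no assignment, to each graph $H$ isomorphic to $G$, of a vector space isomorphism $\psi_H:\mathbf{C}\mathcal{T}(H)\to\mathbf{C}K(H)$ such that $\psi_{H'}\circ f_{\mathcal{T}}=f_K\circ\psi_H$ for every graph isomorphism $f:H\to H'$ between such graphs.
   Context: Graphs are finite multigraphs; an undirected edge is regarded as a pair of oppositely oriented directed edges. For a graph $G=(V,E)$, $A(G)$ is the $V\times V$ matrix whose $(v,w)$-entry is the number of directed edges from $v$ to $w$, $\Delta(G)$ is diagonal with $\Delta_{vv}=\sum_wA_{vw}$, and $Q(G)=\Delta(G)-A(G)$. The critical group is $\mathcal{K}(G)=\mathbf{Z}^V/Q(G)^{\dagger}\mathbf{Z}^V$ ($\dagger$ = transpose) and $K(G)$ is its torsion subgroup. $\mathcal{T}(G)$ is the set of spanning trees of $G$, and $\mathbf{C}\mathcal{T}(G)$, $\mathbf{C}K(G)$ denote the complex vector spaces with bases $\mathcal{T}(G)$ and $K(G)$ respectively. For a graph isomorphism $f:G\to H$, $f_{\mathcal{T}}:\mathbf{C}\mathcal{T}(G)\to\mathbf{C}\mathcal{T}(H)$ is the linear extension of the map sending each spanning tree to its image under $f$; and with $\Phi$ the $V(H)\times V(G)$ matrix with $\Phi_{vw}=1$ if $f(w)=v$ and $0$ otherwise, $f$ induces the group isomorphism $\mathcal{K}(G)\to\mathcal{K}(H)$, $\mathbf{x}+Q(G)^{\dagger}\mathbf{Z}^{V(G)}\mapsto\Phi\mathbf{x}+Q(H)^{\dagger}\mathbf{Z}^{V(H)}$,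 whose restriction $K(G)\to K(H)$ extended linearly is denoted $f_K:\mathbf{C}K(G)\to\mathbf{C}K(H)$. -}

module Defs where

open import Level using (0ℓ)
open import Data.Nat as ℕ using (ℕ; zero; suc)
open import Data.Integer as ℤ using (ℤ; +_; _-_)
open import Data.Fin as Fin using (Fin; zero; suc)
open import Data.Vec as Vec using (Vec; lookup; tabulate; replicate)
open import Data.List using (List; []; _∷_; _++_; [_])
open import Data.List.Relation.Unary.Unique.Propositional using (Unique)
open import Data.Bool using (Bool; true; false; if_then_else_; _∧_)
open import Data.Product using (Σ; ∃; _×_; _,_; proj₁; proj₂)
open import Data.Sum using (_⊎_)
open import Data.Unit using (⊤)
open import Relation.Nullary using (¬_; does)
open import Relation.Binary.PropositionalEquality using (_≡_)
open import Function.Bundles using (Inverse; _↔_)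
open import Algebra.Bundles using (CommutativeRing)

record Field : Set₁ where
  field
    commRing : CommutativeRing 0ℓ 0ℓ
  open CommutativeRing commRing public
  field
    0≉1 : ¬ (0# ≈ 1#)
    inverse : ∀ x → ¬ (x ≈ 0#) → Σ Carrier λ y → x * y ≈ 1#

module _ (F : Field) where
  open Field F

  ι : ℕ → Carrier
  ι zero = 0#
  ι (suc n) = 1# + ι n

  CharacteristicZero : Set
  CharacteristicZero = ∀ n → ¬ (ι (suc n) ≈ 0#)

  evalPoly : List Carrier → Carrier → Carrier
  evalPoly [] x = 0#
  evalPoly (c ∷ cs) x = c + x * evalPoly cs x

  AlgebraicallyClosed : Set
  AlgebraicallyClosed =
    ∀ (c₀ : Carrier) (cs : List Carrier) (a : Carrier) → ¬ (a ≈ 0#) →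
    Σ Carrier λ x → evalPoly (c₀ ∷ (cs ++ [ a ])) x ≈ 0#

-- Finite undirected multigraphs: vertices Fin nV, undirected edges Fin nE,
-- each undirected edge e with ends (u , w) being the pair of directed edges
-- u → w and w → u (loops allowed).

record Graph : Set where
  field
    nV : ℕ
    nE : ℕ
    ends : Fin nE → Fin nV × Fin nV
open Graph public

Joins : (G : Graph) → Fin (nE G) → Fin (nV G) → Fin (nV G) → Set
Joins G e u w = (ends G e ≡ (u , w)) ⊎ (ends G e ≡ (w , u))

data Walk (G : Graph) (S : Vec Bool (nE G)) : Fin (nV G) → Fin (nV G) → Set where
  [] : ∀ {u} → Walk G S u u
  step : ∀ {u w v} (e : Fin (nE G)) → lookup S e ≡ true → Joins G e u w →
         Walk G S w v → Walk G S u v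

edgesOf : ∀ {G S u v} → Walk G S u v → List (Fin (nE G))
edgesOf [] = []
edgesOf (step e _ _ w) = e ∷ edgesOf w

SpanConnected : (G : Graph) → Vec Bool (nE G) → Set
SpanConnected G S = ∀ u v → Walk G S u v

Acyclic : (G : Graph) → Vec Bool (nE G) → Set
Acyclic G S = ∀ u (w : Walk G S u u) → Unique (edgesOf w) → edgesOf w ≡ []

IsSpanningTree : (G : Graph) → Vec Bool (nE G) → Set
IsSpanningTree G S = SpanConnected G S × Acyclic G S

Connected : Graph → Set
Connected G = SpanConnected G (replicate (nE G) true)

∑ : (n : ℕ) → (Fin n → ℤ) → ℤ
∑ zero f = + 0
∑ (suc n) f = f zero ℤ.+ ∑ n (λ i → f (suc i))

_==_ : ∀ {n} → Fin n → Fin n → Bool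
i == j = does (i Fin.≟ j)

Adj : (G : Graph) → Fin (nV G) → Fin (nV G) → ℤ
Adj G v w = ∑ (nE G) λ e →
  (if (proj₁ (ends G e) == v) ∧ (proj₂ (ends G e) == w) then + 1 else + 0)
  ℤ.+ (if (proj₁ (ends G e) == w) ∧ (proj₂ (ends G e) == v) then + 1 else + 0)

Deg : (G : Graph) → Fin (nV G) → ℤ
Deg G v = ∑ (nV G) (Adj G v)

Lap : (G : Graph) → Fin (nV G) → Fin (nV G) → ℤ
Lap G v w = (if v == w then Deg G v else + 0) - Adj G v w

LapT : (G : Graph) → (Fin (nV G) → ℤ) → Fin (nV G) → ℤ
LapT G z v = ∑ (nV G) λ w → Lap G w v ℤ.* z w

InImage : (G : Graph) → (Fin (nV G) → ℤ) → Set
InImage G x = Σ (Fin (nV G) → ℤ) λ z → ∀ v → x v ≡ LapT G z v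

-- the class of x in 𝒦(G) is torsion, i.e. lies in K(G)
Torsion : (G : Graph) → (Fin (nV G) → ℤ) → Set
Torsion G x = Σ ℕ λ n → InImage G (λ v → + (suc n) ℤ.* x v)

SameK : (G : Graph) → (Fin (nV G) → ℤ) → (Fin (nV G) → ℤ) → Set
SameK G x y = Torsion G x × InImage G (λ v → x v - y v)

record GraphIso (G H : Graph) : Set where
  field
    vmap : Fin (nV G) ↔ Fin (nV H)
    emap : Fin (nE G) ↔ Fin (nE H)
    incid : ∀ e → Joins H (Inverse.to emap e)
                      (Inverse.to vmap (proj₁ (ends G e)))
                      (Inverse.to vmap (proj₂ (ends G e)))
open GraphIso public

-- Free vector spaces over F on a set presented by representatives.
-- A "presented basis" consists of a type Pt of representatives, a predicate
-- D picking out the representatives that denote basis elements, and a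
-- well-formedness predicate WF on functions Pt → F (independence of the
-- chosen representative).  A vector is a WF function Pt → F; two vectors
-- are equal when they agree on all D-representatives.

record Presented : Set₁ where
  field
    Pt : Set
    D : Pt → Set
    Rel : Pt → Pt → Set      -- identification of representatives

module _ (F : Field) where
  open Field F

  module _ (X : Presented) where
    open Presented X
    Vect : Set
    Vect = Pt → Carrier

    WF : Vect → Set
    WF u = ∀ x y → Rel x y → u x ≈ u y

    _≋_ : Vect → Vect → Set
    u ≋ v = ∀ x → D x → u x ≈ v x

    _⊕_ : Vect → Vect → Vect
    (u ⊕ v) x = u x + v x

    _⊙_ : Carrier → Vect → Vect
    (a ⊙ u) x = a * u x

  record LinIso (X Y : Presented) : Set where
    field
      to : Vect X → Vect Y
      from : Vect Y → Vect X
      to-wf : ∀ u → WF X u → WF Y (to u)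
      from-wf : ∀ v → WF Y v → WF X (from v)
      to-cong : ∀ u u' → WF X u → WF X u' → _≋_ X u u' → _≋_ Y (to u) (to u')
      from-cong : ∀ v v' → WF Y v → WF Y v' → _≋_ Y v v' → _≋_ X (from v) (from v')
      to-add : ∀ u u' → WF X u → WF X u' →
               _≋_ Y (to (_⊕_ X u u')) (_⊕_ Y (to u) (to u'))
      to-scale : ∀ a u → WF X u → _≋_ Y (to (_⊙_ X a u)) (_⊙_ Y a (to u))
      from-to : ∀ u → WF X u → _≋_ X (from (to u)) u
      to-from : ∀ v → WF Y v → _≋_ Y (to (from v)) v

TreeBasis : Graph → Presented
TreeBasis G = record
  { Pt = Vec Bool (nE G)
  ; D = IsSpanningTree G
  ; Rel = _≡_ }

-- ℂK(G): basis the elements of K(G), represented by torsion vectors in ℤ^V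
KBasis : Graph → Presented
KBasis G = record
  { Pt = Fin (nV G) → ℤ
  ; D = Torsion G
  ; Rel = SameK G }

module _ (F : Field) where
  -- f_𝒯 : (f_𝒯 u)(S') = u(f⁻¹ S'), since f_𝒯 sends tree t to f(t)
  f𝒯 : ∀ {H H'} → GraphIso H H' → Vect F (TreeBasis H) → Vect F (TreeBasis H')
  f𝒯 f u S' = u (tabulate λ e → lookup S' (Inverse.to (emap f) e))

  -- f_K : (f_K u)(y) = u(Φ⁻¹ y), Φ⁻¹ y = y ∘ f on vertices, since x ↦ Φ x = x ∘ f⁻¹
  fK : ∀ {H H'} → GraphIso H H' → Vect F (KBasis H) → Vect F (KBasis H')
  fK f u y = u (λ w → y (Inverse.to (vmap f) w))

  NaturalIso : Graph → Set
  NaturalIso G =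
    Σ ((H : Graph) → GraphIso G H → LinIso F (TreeBasis H) (KBasis H)) λ ψ →
      ∀ H H' (p : GraphIso G H) (p' : GraphIso G H') (f : GraphIso H H')
        (u : Vect F (TreeBasis H)) →
        _≋_ F (KBasis H') (LinIso.to (ψ H' p') (f𝒯 f u))
                          (fK f (LinIso.to (ψ H p) u))

-- A natural isomorphism commutes with every automorphism of G.  An automorphism
-- fixing every vertex acts trivially on K(G), since its matrix Φ is the identity;
-- so naturality and injectivity of ψ force it to fix every spanning tree.  The
-- digon (two vertices joined by two parallel edges) has the automorphism
-- exchanging its edges, which exchanges its two spanning trees.  The argument
-- works over any field.
module Submission where

open import Defs
open import Data.Bool using (Bool; true; false; if_then_else_)
open import Data.Bool.Properties using () renaming (_≟_ to _≟ᵇ_)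
open import Data.Empty using (⊥-elim)
open import Data.Fin using (Fin; zero; suc)
open import Data.Fin.Permutation using (transpose)
open import Data.Integer as ℤ using (ℤ; +_)
open import Data.Integer.Properties using (*-zeroʳ; i≡j⇒i-j≡0)
open import Data.List.Relation.Unary.All using (_∷_)
open import Data.List.Relation.Unary.AllPairs using (_∷_)
open import Data.Nat using (zero; suc)
open import Data.Product using (Σ; _×_; _,_)
open import Data.Sum using (inj₁; inj₂)
open import Data.Vec using (Vec; []; _∷_; lookup)
open import Data.Vec.Properties using (≡-dec)
open import Function.Bundles using (Inverse)
open import Function.Construct.Identity using (↔-id)
open import Relation.Nullary using (¬_; does)
open import Relation.Binary.PropositionalEquality using (_≡_; refl; sym; trans; cong; cong₂)

∑-zero : ∀ n (f : Fin n → ℤ) → (∀ i → f i ≡ + 0) → ∑ n f ≡ + 0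
∑-zero zero    f f≡0 = refl
∑-zero (suc n) f f≡0 = cong₂ ℤ._+_ (f≡0 zero) (∑-zero n (λ i → f (suc i)) (λ i → f≡0 (suc i)))

LapT-zero : ∀ G v → LapT G (λ _ → + 0) v ≡ + 0
LapT-zero G v = ∑-zero (nV G) _ (λ w → *-zeroʳ (Lap G w v))

SameK-pointwise : ∀ G (x y : Fin (nV G) → ℤ) →
                  Torsion G x → (∀ v → x v ≡ y v) → SameK G x y
SameK-pointwise G x y tx x≗y =
  tx , (λ _ → + 0) , λ v → trans (i≡j⇒i-j≡0 (x≗y v)) (sym (LapT-zero G v))

VertexFixing : ∀ {G} → GraphIso G G → Set
VertexFixing f = ∀ v → Inverse.to (vmap f) v ≡ v

module _ (F : Field) where
  open Field F using (Carrier; 0#; 1#)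
    renaming (refl to ≈-refl; sym to ≈-sym; trans to ≈-trans)

  TreeVect-WF : ∀ G u → WF F (TreeBasis G) u
  TreeVect-WF G u S .S refl = ≈-refl

  fK-vertexFixing : ∀ {G} (f : GraphIso G G) → VertexFixing f →
                    ∀ u → WF F (KBasis G) u → _≋_ F (KBasis G) (fK F f u) u
  fK-vertexFixing {G} f fixed u u-wf y y-torsion =
    ≈-sym (u-wf y _ (SameK-pointwise G y _ y-torsion (λ v → cong y (sym (fixed v)))))

  LinIso-to-injective : ∀ {X Y} (L : LinIso F X Y) → ∀ u u' → WF F X u → WF F X u' →
                        _≋_ F Y (LinIso.to L u) (LinIso.to L u') → _≋_ F X u u'
  LinIso-to-injective L u u' u-wf u'-wf Lu≋Lu' x dx =
    ≈-trans (≈-sym (from-to u u-wf x dx))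
            (≈-trans (from-cong (to u) (to u') (to-wf u u-wf) (to-wf u' u'-wf) Lu≋Lu' x dx)
                     (from-to u' u'-wf x dx))
    where open LinIso L

  NaturalIso-vertexFixing-f𝒯 : ∀ {G} → NaturalIso F G → (f : GraphIso G G) → VertexFixing f →
                               ∀ u → _≋_ F (TreeBasis G) (f𝒯 F f u) u
  NaturalIso-vertexFixing-f𝒯 {G} (ψ , natural) f fixed u =
    LinIso-to-injective (ψ G f) (f𝒯 F f u) u (TreeVect-WF G _) (TreeVect-WF G u)
      λ y y-torsion → ≈-trans (natural G G f f f u y y-torsion)
                              (fK-vertexFixing f fixed (to u) (to-wf u (TreeVect-WF G u)) y y-torsion)
    where open LinIso (ψ G f)

  basisVector : ∀ {n} → Vec Bool n → Vec Bool n → Carrier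
  basisVector t S = if does (≡-dec _≟ᵇ_ t S) then 1# else 0#

digon : Graph
digon = record { nV = 2 ; nE = 2 ; ends = λ _ → (zero , suc zero) }

digon-spanConnected : ∀ S e → lookup S e ≡ true → SpanConnected digon S
digon-spanConnected S e e∈S zero       zero       = []
digon-spanConnected S e e∈S zero       (suc zero) = step e e∈S (inj₁ refl) []
digon-spanConnected S e e∈S (suc zero) zero       = step e e∈S (inj₂ refl) []
digon-spanConnected S e e∈S (suc zero) (suc zero) = []

digon-connected : Connected digon
digon-connected = digon-spanConnected _ zero refl

secondEdge : Vec Bool 2
secondEdge = false ∷ true ∷ []

secondEdge-acyclic : Acyclic digon secondEdge
secondEdge-acyclic _ [] _ = refl
secondEdge-acyclic _ (step zero () _ _) _
secondEdge-acyclic _ (step (suc zero) _ (inj₁ ()) []) _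
secondEdge-acyclic _ (step (suc zero) _ (inj₂ ()) []) _
secondEdge-acyclic _ (step (suc zero) _ _ (step zero () _ _)) _
secondEdge-acyclic _ (step (suc zero) _ _ (step (suc zero) _ _ _)) ((e≢e ∷ _) ∷ _) = ⊥-elim (e≢e refl)

secondEdge-spanningTree : IsSpanningTree digon secondEdge
secondEdge-spanningTree = digon-spanConnected secondEdge (suc zero) refl , secondEdge-acyclic

exchangeEdges : GraphIso digon digon
exchangeEdges = record
  { vmap  = ↔-id _
  ; emap  = transpose zero (suc zero)
  ; incid = λ _ → inj₁ refl
  }

-- Exchanging the edges moves the basis vector of the tree {e₀} to that of {e₁};
-- evaluated at {e₁}, the fixed-tree identity reads 1 ≈ 0.
digon-noNaturalIso : (F : Field) → ¬ NaturalIso F digon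
digon-noNaturalIso F ψ =
  0≉1 (≈-sym (NaturalIso-vertexFixing-f𝒯 F ψ exchangeEdges (λ _ → refl)
             (basisVector F (true ∷ false ∷ [])) secondEdge secondEdge-spanningTree))
  where open Field F using (0≉1) renaming (sym to ≈-sym)

theorem8p1 : Σ Graph λ G → Connected G ×
               ((F : Field) → CharacteristicZero F → AlgebraicallyClosed F →
                 ¬ NaturalIso F G)
theorem8p1 = digon , digon-connected , λ F _ _ → digon-noNaturalIso F
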